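{- Let $\mathcal{H}$ be a class of graphs (respectively digraphs). For every graph (respectively digraph) $G$, we have $\Psi_{\mathcal{H}}(G)\le\tau_{\mathcal{H}}(G)+1$.
   Context: A graph (digraph) is \emph{$\mathcal{H}$-free} if it contains no member of $\mathcal{H}$ as an induced sub(di)graph. $\tau_{\mathcal{H}}(G)$ is the minimum size of a set $F\subseteq V(G)$ such that $G-F$ is $\mathcal{H}$-free. An \emph{$\mathcal{H}$-coloring} of $G$ is a partition of $V(G)$ into sets each inducing an $\mathcal{H}$-free sub(di)graph; it is \emph{complete} if the union of any two distinct color classes induces a sub(di)graph containing a member of $\mathcal{H}$ as an induced sub(di)graph. $\Psi_{\mathcal{H}}(G)$ is the largest number of colors in a complete $\mathcal{H}$-coloring of $G$. -}

module Defs where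

open import Data.Nat using (ℕ; _≤_; suc)
open import Data.Fin using (Fin)
open import Data.Fin.Subset using (Subset; _∉_; ∣_∣)
open import Data.Bool using (Bool; false)
open import Data.Product using (Σ; _×_; ∃)
open import Data.Sum using (_⊎_)
open import Function.Definitions using (Injective; Surjective)
open import Relation.Binary.PropositionalEquality using (_≡_; _≢_)
open import Relation.Nullary using (¬_)

-- Finite loopless digraphs on vertex set Fin n (adjacency u → v given by adj u v).
record Digraph (n : ℕ) : Set where
  field
    adj    : Fin n → Fin n → Bool
    irrefl : ∀ v → adj v v ≡ false

record Graph (n : ℕ) : Set where
  field
    adj    : Fin n → Fin n → Bool
    irrefl : ∀ v → adj v v ≡ false
    sym    : ∀ u v → adj u v ≡ adj v u

module Generic (Str : ℕ → Set) (adjOf : ∀ {n} → Str n → Fin n → Fin n → Bool) where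

  Class : Set₁
  Class = ∀ {m} → Str m → Set

  InducedEmbedding : ∀ {m n} → Str m → Str n → (Fin n → Set) → (Fin m → Fin n) → Set
  InducedEmbedding H G S f =
    Injective _≡_ _≡_ f × (∀ i → S (f i)) × (∀ i j → adjOf H i j ≡ adjOf G (f i) (f j))

  Contains : Class → ∀ {n} → Str n → (Fin n → Set) → Set
  Contains 𝓗 {n} G S =
    Σ ℕ λ m → Σ (Str m) λ H → 𝓗 H × Σ (Fin m → Fin n) λ f → InducedEmbedding H G S f

  Free : Class → ∀ {n} → Str n → (Fin n → Set) → Set
  Free 𝓗 G S = ¬ Contains 𝓗 G S

  Hitting : Class → ∀ {n} → Str n → Subset n → Set
  Hitting 𝓗 G F = Free 𝓗 G (λ v → v ∉ F)

  IsTau : Class → ∀ {n} → Str n → ℕ → Set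
  IsTau 𝓗 {n} G t =
    (Σ (Subset n) λ F → ∣ F ∣ ≡ t × Hitting 𝓗 G F) ×
    (∀ (F : Subset n) → Hitting 𝓗 G F → t ≤ ∣ F ∣)

  -- An 𝓗-coloring with k colors: a partition of V(G) into k (nonempty)
  -- classes c⁻¹(i), each inducing an 𝓗-free sub(di)graph.
  IsColoring : Class → ∀ {n} → Str n → (k : ℕ) → (Fin n → Fin k) → Set
  IsColoring 𝓗 G k c =
    Surjective _≡_ _≡_ c × (∀ i → Free 𝓗 G (λ v → c v ≡ i))

  IsCompleteColoring : Class → ∀ {n} → Str n → (k : ℕ) → (Fin n → Fin k) → Set
  IsCompleteColoring 𝓗 G k c =
    IsColoring 𝓗 G k c ×
    (∀ i j → i ≢ j → Contains 𝓗 G (λ v → c v ≡ i ⊎ c v ≡ j))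

  IsPsi : Class → ∀ {n} → Str n → ℕ → Set
  IsPsi 𝓗 {n} G p =
    (Σ (Fin n → Fin p) λ c → IsCompleteColoring 𝓗 G p c) ×
    (∀ k (c : Fin n → Fin k) → IsCompleteColoring 𝓗 G k c → k ≤ p)

module G = Generic Graph Graph.adj
module D = Generic Digraph Digraph.adj

module Submission where

-- Let c be a complete 𝓗-coloring with p colours and F a set of τ vertices
-- such that G - F is 𝓗-free.  If two distinct colour classes i and j both
-- missed F, their union would lie inside G - F; completeness puts a member of
-- 𝓗 there, contradicting the choice of F.  Hence at most one colour is absent
-- from the list c(F) of colours met by F, and that list has at most |F| = τ
-- entries, so p ≤ τ + 1.

open import Defs
open import Data.Nat using (ℕ; _≤_; suc)
open import Data.Nat.Properties using (module ≤-Reasoning)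
open import Data.Fin using (Fin; zero; suc; _≟_)
open import Data.Fin.Properties using (injective⇒≤; suc-injective)
open import Data.Fin.Subset using (Subset; inside; outside; ∣_∣)
  renaming (_∈_ to _∈ₛ_; _∉_ to _∉ₛ_)
open import Data.Vec using (_∷_; []; here; there)
open import Data.List using (List; length; map; lookup)
open import Data.List.Properties using (length-map)
open import Data.List.Relation.Unary.Any using (index)
  renaming (here to hereₗ; there to thereₗ)
open import Data.List.Relation.Unary.Any.Properties using (lookup-index)
open import Data.List.Membership.Propositional using (_∈_; _∉_)
open import Data.List.Membership.Propositional.Properties using (∈-map⁺)
import Data.List.Membership.DecPropositional as DecMembership
open import Data.Bool using (Bool)
open import Data.Product using (_×_; _,_)
open import Data.Sum using (inj₁; inj₂)
open import Data.Empty using (⊥; ⊥-elim)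
open import Relation.Nullary using (Dec; yes; no)
open import Relation.Binary.PropositionalEquality
  using (_≡_; _≢_; refl; sym; trans; cong; subst)

elements : ∀ {n} → Subset n → List (Fin n)
elements []            = List.[]
elements (outside ∷ F) = map suc (elements F)
elements (inside ∷ F)  = zero List.∷ map suc (elements F)

length-elements : ∀ {n} (F : Subset n) → length (elements F) ≡ ∣ F ∣
length-elements []            = refl
length-elements (outside ∷ F) = trans (length-map suc (elements F)) (length-elements F)
length-elements (inside ∷ F)  = cong suc (trans (length-map suc (elements F)) (length-elements F))

∈-elements : ∀ {n} {F : Subset n} {v : Fin n} → v ∈ₛ F → v ∈ elements F
∈-elements {F = outside ∷ F} {suc v} (there v∈F) = ∈-map⁺ suc (∈-elements v∈F)
∈-elements {F = inside ∷ F}  {zero}  here        = hereₗ refl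
∈-elements {F = inside ∷ F}  {suc v} (there v∈F) = thereₗ (∈-map⁺ suc (∈-elements v∈F))

-- If at most one element of Fin p is absent from xs, then p ≤ 1 + length xs:
-- send a member of xs to (one plus) its position in xs, and the possible
-- absent element to 0; this is an injection Fin p → Fin (1 + length xs).
≤-suc-length : ∀ {p} (xs : List (Fin p)) →
               (∀ i j → i ≢ j → i ∉ xs → j ∉ xs → ⊥) → p ≤ suc (length xs)
≤-suc-length {p} xs atMostOneAbsent = injective⇒≤ slot-injective
  where
  open DecMembership (_≟_ {p}) using (_∈?_)

  position : ∀ i → Dec (i ∈ xs) → Fin (suc (length xs))
  position i (yes i∈xs) = suc (index i∈xs)
  position i (no _)     = zero

  slot : Fin p → Fin (suc (length xs))
  slot i = position i (i ∈? xs)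

  slot-injective : ∀ {i j} → slot i ≡ slot j → i ≡ j
  slot-injective {i} {j} eq with i ∈? xs | j ∈? xs
  ... | yes i∈xs | yes j∈xs =
    trans (lookup-index i∈xs)
          (trans (cong (lookup xs) (suc-injective eq)) (sym (lookup-index j∈xs)))
  ... | no i∉xs  | no j∉xs with i ≟ j
  ...   | yes i≡j = i≡j
  ...   | no i≢j  = ⊥-elim (atMostOneAbsent i j i≢j i∉xs j∉xs)
  slot-injective () | yes _ | no _
  slot-injective () | no _  | yes _

module Bound (Str : ℕ → Set) (adjOf : ∀ {n} → Str n → Fin n → Fin n → Bool) where
  open Generic Str adjOf

  MissesClass : ∀ {n k} → (Fin n → Fin k) → Subset n → Fin k → Set
  MissesClass c F i = ∀ v → v ∈ₛ F → c v ≢ i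

  ∉-image⇒misses : ∀ {n k} (c : Fin n → Fin k) (F : Subset n) (i : Fin k) →
                   i ∉ map c (elements F) → MissesClass c F i
  ∉-image⇒misses c F i i∉cF v v∈F cv≡i =
    i∉cF (subst (_∈ map c (elements F)) cv≡i (∈-map⁺ c (∈-elements v∈F)))

  -- Key lemma: for a complete 𝓗-coloring and a set F meeting every induced
  -- copy of a member of 𝓗, no two distinct colour classes both miss F, since
  -- their union would then carry a copy of a member of 𝓗 inside G - F.
  two-classes-meet : ∀ (𝓗 : Class) {n k} (G : Str n) (c : Fin n → Fin k) (F : Subset n) →
                     IsCompleteColoring 𝓗 G k c → Hitting 𝓗 G F →
                     ∀ i j → i ≢ j → MissesClass c F i → MissesClass c F j → ⊥
  two-classes-meet 𝓗 G c F (_ , complete) hitting i j i≢j missᵢ missⱼ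
    with complete i j i≢j
  ... | m , H , H∈𝓗 , f , f-injective , f-inUnion , f-adj =
    hitting (m , H , H∈𝓗 , f , f-injective , f-avoidsF , f-adj)
    where
    f-avoidsF : ∀ x → f x ∉ₛ F
    f-avoidsF x fx∈F with f-inUnion x
    ... | inj₁ cfx≡i = missᵢ (f x) fx∈F cfx≡i
    ... | inj₂ cfx≡j = missⱼ (f x) fx∈F cfx≡j

  psi≤suc-tau : ∀ (𝓗 : Class) {n} (G : Str n) (p t : ℕ) →
                IsPsi 𝓗 G p → IsTau 𝓗 G t → p ≤ suc t
  psi≤suc-tau 𝓗 G p t ((c , complete) , _) ((F , ∣F∣≡t , hitting) , _) = begin
    p                                  ≤⟨ ≤-suc-length colours atMostOneAbsent ⟩
    suc (length colours)               ≡⟨ cong suc (length-map c (elements F)) ⟩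
    suc (length (elements F))          ≡⟨ cong suc (trans (length-elements F) ∣F∣≡t) ⟩
    suc t                              ∎
    where
    open ≤-Reasoning
    colours = map c (elements F)

    atMostOneAbsent : ∀ i j → i ≢ j → i ∉ colours → j ∉ colours → ⊥
    atMostOneAbsent i j i≢j i∉ j∉ =
      two-classes-meet 𝓗 G c F complete hitting i j i≢j
        (∉-image⇒misses c F i i∉) (∉-image⇒misses c F j j∉)

proposition4p2 :
    (∀ (𝓗 : G.Class) {n} (Gr : Graph n) (p t : ℕ) →
      G.IsPsi 𝓗 Gr p → G.IsTau 𝓗 Gr t → p ≤ suc t)
    ×
    (∀ (𝓗 : D.Class) {n} (Gr : Digraph n) (p t : ℕ) →
      D.IsPsi 𝓗 Gr p → D.IsTau 𝓗 Gr t → p ≤ suc t)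
proposition4p2 = Bound.psi≤suc-tau Graph Graph.adj , Bound.psi≤suc-tau Digraph Digraph.adj
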